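{- Let $G$ be a finite simple graph and $k$ a positive integer, and let $F_{G,k}=\bigwedge_{i\in[k]}\chi_i\land\bigwedge_{\{u,v\}\in E(G)}\chi_{uv}$. An assignment to $\{x_i[uv]\mid i\in[k],\{u,v\}\in E(G)\}$ (both orientations) satisfies $F_{G,k}$ if and only if it equals $\alpha_S$ for some ordered $k$-clique $S$ of $G$.
   Context: $[k]=\{1,\dots,k\}$, $N(u)$ is the set of neighbours of $u$ in $G$. For every $i\in[k]$ and every edge $\{u,v\}\in E(G)$ there are two Boolean variables $x_i[uv]$ and $x_i[vu]$. The constraints are $\chi_i=\bigvee_{u\in V(G)}\Big(\big(\sum_{v\in N(u)}x_i[uv]=k-1\big)\land\big(\sum_{\{v,w\}\in E(G)}(x_i[vw]+x_i[wv])=k-1\big)\Big)$ for $i\in[k]$, and $\chi_{uv}=\Big(\big(\sum_{i\in[k]}x_i[uv]=1\big)\land\big(\sum_{i\in[k]}x_i[vu]=1\big)\Big)\lor\bigwedge_{i\in[k]}\big(x_i[uv]=x_i[vu]=0\big)$ for $\{u,v\}\in E(G)$ (sums over integers). An ordered $k$-clique is a sequence $S=(s_1,\dots,s_k)$ of pairwise distinct, pairwise adjacent vertices; $\mathit{set}(S)=\{s_1,\dots,s_k\}$. The assignment $\alpha_S$ sets $x_i[uv]$ to $1$ iff $u=s_i$ and $v\in N(u)\cap\mathit{set}(S)$, and to $0$ otherwise. -}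

module Defs where

open import Data.Nat using (ℕ; zero; suc; _+_; _∸_)
open import Data.Bool using (Bool; true; false; _∧_; if_then_else_)
open import Data.Fin using (Fin; zero; suc; _<?_)
open import Data.Fin.Properties using (_≟_; any?)
open import Data.Product using (Σ; ∃; _×_)
open import Data.Sum using (_⊎_)
open import Relation.Nullary using (¬_; does)
open import Relation.Binary.PropositionalEquality using (_≡_)

record Graph (n : ℕ) : Set where
  field
    Adj    : Fin n → Fin n → Bool
    sym    : ∀ u v → Adj u v ≡ Adj v u
    irrefl : ∀ u → Adj u u ≡ false
open Graph public

sumFin : (n : ℕ) → (Fin n → ℕ) → ℕ
sumFin zero    f = 0
sumFin (suc n) f = f zero + sumFin n (λ i → f (suc i))

b2n : Bool → ℕ
b2n true  = 1
b2n false = 0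

-- An assignment to the variables x_i[uv]; only the values at ordered pairs
-- (u,v) with {u,v} ∈ E(G) are variables of the formula, the rest is ignored.
Assignment : (k n : ℕ) → Set
Assignment k n = Fin k → Fin n → Fin n → Bool

module _ {n : ℕ} (G : Graph n) (k : ℕ) (x : Assignment k n) where

  nbrSum : Fin k → Fin n → ℕ
  nbrSum i u = sumFin n (λ v → if Adj G u v then b2n (x i u v) else 0)

  edgeSum : Fin k → ℕ
  edgeSum i = sumFin n (λ v → sumFin n (λ w →
    if does (v <? w) ∧ Adj G v w then b2n (x i v w) + b2n (x i w v) else 0))

  χ : Fin k → Set
  χ i = Σ (Fin n) λ u → (nbrSum i u ≡ k ∸ 1) × (edgeSum i ≡ k ∸ 1)

  χE : Fin n → Fin n → Set
  χE u v = ((sumFin k (λ i → b2n (x i u v)) ≡ 1) × (sumFin k (λ i → b2n (x i v u)) ≡ 1))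
         ⊎ (∀ (i : Fin k) → (x i u v ≡ false) × (x i v u ≡ false))

  F : Set
  F = (∀ (i : Fin k) → χ i) × (∀ (u v : Fin n) → Adj G u v ≡ true → χE u v)

record OrderedClique {n : ℕ} (G : Graph n) (k : ℕ) : Set where
  field
    s        : Fin k → Fin n
    distinct : ∀ i j → ¬ (i ≡ j) → ¬ (s i ≡ s j)
    adjacent : ∀ i j → ¬ (i ≡ j) → Adj G (s i) (s j) ≡ true
open OrderedClique public

α : {n : ℕ} {G : Graph n} {k : ℕ} → OrderedClique G k → Assignment k n
α {G = G} S i u v =
  does (u ≟ s S i) ∧ Adj G u v ∧ does (any? (λ j → v ≟ s S j))

EqualsOnVars : {n : ℕ} (G : Graph n) {k : ℕ} → Assignment k n → Assignment k n → Set
EqualsOnVars G {k} x y = ∀ (i : Fin k) u v → Adj G u v ≡ true → x i u v ≡ y i u v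

{-# OPTIONS --safe #-}
-- Call a true variable x_i[uv] an arc of colour i.  Since every edge is listed once in
-- edgeSum, the number of arcs of colour i equals the sum of the out-degrees nbrSum i u; so χ_i forces all k - 1 arcs of colour i
-- to leave a single vertex, the source s_i.  By χ_uv every arc of colour i is answered by
-- an arc of some colour l pointing back, so its head is a source s_l with l ≠ i.  Counting
-- the indices l ≠ i with multiplicity gives exactly k - 1 candidate heads for k - 1 arcs,
-- hence s_i has an arc of colour i to every s_j with j ≠ i: the sources form an ordered
-- clique S and x agrees with α_S.  Conversely α_S satisfies F, and F only reads the
-- variables, i.e. the values on edges.

module Submission where

open import Defs hiding (sym)
open import Data.Bool using (Bool; true; false; not; _∧_; if_then_else_)
open import Data.Bool.Properties using (∧-zeroʳ; ¬-not; if-cong; if-cong-then; if-eta)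
open import Data.Fin using (Fin; zero; suc; _<?_)
open import Data.Fin.Properties using (_≟_; suc-injective; any?; <-cmp; <-irrefl)
open import Data.Nat using (ℕ; zero; suc; _+_; _∸_; _≤_; _<_; z≤n; z<s)
open import Data.Nat.Properties
  using (+-0-commutativeMonoid; +-comm; ≤-trans; ≤-antisym; +-mono-≤; +-monoʳ-≤; m≤m+n; m≤n+m;
         +-cancelˡ-≤; +-cancelʳ-≤; +-cancelˡ-≡; +-identityʳ; n≤0⇒n≡0; >⇒≢; module ≤-Reasoning)
open import Algebra.Properties.CommutativeMonoid.Sum +-0-commutativeMonoid
  using (sum; sum-cong-≗; ∑-distrib-+; ∑-comm)
open import Data.Product using (Σ; ∃; _×_; _,_; proj₁; proj₂)
open import Data.Product as Product using ()
open import Data.Sum using (inj₁; inj₂)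
open import Function using (_∘_; id)
open import Relation.Binary.Definitions using (tri<; tri≈; tri>)
open import Relation.Binary.PropositionalEquality
open import Relation.Nullary using (¬_; Dec; does; yes; no; contradiction)
open import Relation.Nullary.Decidable using (dec-true; dec-false; decidable-stable)

private variable
  m n : ℕ

sumFin-cong : ∀ n {f g : Fin n → ℕ} → (∀ i → f i ≡ g i) → sumFin n f ≡ sumFin n g
sumFin-cong zero    f≗g = refl
sumFin-cong (suc n) f≗g = cong₂ _+_ (f≗g zero) (sumFin-cong n (f≗g ∘ suc))

sumFin≡sum : ∀ n (f : Fin n → ℕ) → sumFin n f ≡ sum f
sumFin≡sum zero    f = refl
sumFin≡sum (suc n) f = cong (f zero +_) (sumFin≡sum n (f ∘ suc))

sumFin-distrib-+ : ∀ n (f g : Fin n → ℕ) →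
                   sumFin n (λ i → f i + g i) ≡ sumFin n f + sumFin n g
sumFin-distrib-+ n f g = begin
  sumFin n (λ i → f i + g i) ≡⟨ sumFin≡sum n _ ⟩
  sum (λ i → f i + g i)      ≡⟨ ∑-distrib-+ f g ⟩
  sum f + sum g              ≡⟨ sym (cong₂ _+_ (sumFin≡sum n f) (sumFin≡sum n g)) ⟩
  sumFin n f + sumFin n g    ∎
  where open ≡-Reasoning

sumFin-comm : ∀ m n (f : Fin m → Fin n → ℕ) →
              sumFin m (λ i → sumFin n (f i)) ≡ sumFin n (λ j → sumFin m (λ i → f i j))
sumFin-comm m n f = begin
  sumFin m (λ i → sumFin n (f i))             ≡⟨ sumFin≡sum m _ ⟩
  sum (λ i → sumFin n (f i))                  ≡⟨ sum-cong-≗ (λ i → sumFin≡sum n (f i)) ⟩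
  sum (λ i → sum (f i))                       ≡⟨ ∑-comm f ⟩
  sum (λ j → sum (λ i → f i j))               ≡⟨ sym (sum-cong-≗ (λ j → sumFin≡sum m (λ i → f i j))) ⟩
  sum (λ j → sumFin m (λ i → f i j))          ≡⟨ sym (sumFin≡sum n _) ⟩
  sumFin n (λ j → sumFin m (λ i → f i j))     ∎
  where open ≡-Reasoning

sumFin-zero : ∀ n {f : Fin n → ℕ} → (∀ i → f i ≡ 0) → sumFin n f ≡ 0
sumFin-zero zero    f≗0 = refl
sumFin-zero (suc n) f≗0 rewrite f≗0 zero = sumFin-zero n (f≗0 ∘ suc)

sumFin-singleton-support : ∀ n {f : Fin n → ℕ} i → (∀ j → j ≢ i → f j ≡ 0) → sumFin n f ≡ f i
sumFin-singleton-support (suc n) {f} zero f≗0 =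
  trans (cong (f zero +_) (sumFin-zero n (λ j → f≗0 (suc j) λ ()))) (+-identityʳ (f zero))
sumFin-singleton-support (suc n) (suc i) f≗0 rewrite f≗0 zero (λ ()) =
  sumFin-singleton-support n i (λ j j≢i → f≗0 (suc j) (j≢i ∘ suc-injective))

≤-sumFin : ∀ n (f : Fin n → ℕ) i → f i ≤ sumFin n f
≤-sumFin (suc n) f zero    = m≤m+n _ _
≤-sumFin (suc n) f (suc i) = ≤-trans (≤-sumFin n (f ∘ suc) i) (m≤n+m _ _)

+-≤-sumFin : ∀ n (f : Fin n → ℕ) {i j} → i ≢ j → f i + f j ≤ sumFin n f
+-≤-sumFin (suc n) f {zero}  {zero}  i≢j = contradiction refl i≢j
+-≤-sumFin (suc n) f {zero}  {suc j} i≢j = +-monoʳ-≤ (f zero) (≤-sumFin n (f ∘ suc) j)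
+-≤-sumFin (suc n) f {suc i} {zero}  i≢j =
  subst (_≤ sumFin (suc n) f) (+-comm (f zero) (f (suc i))) (+-monoʳ-≤ (f zero) (≤-sumFin n (f ∘ suc) i))
+-≤-sumFin (suc n) f {suc i} {suc j} i≢j =
  ≤-trans (+-≤-sumFin n (f ∘ suc) (i≢j ∘ cong suc)) (m≤n+m _ _)

sumFin≡⇒otherSources≡0 : ∀ n (f : Fin n → ℕ) {i j} → j ≢ i → sumFin n f ≡ f i → f j ≡ 0
sumFin≡⇒otherSources≡0 n f {i} {j} j≢i sum≡fi = n≤0⇒n≡0 (+-cancelˡ-≤ (f i) (f j) 0 (begin
  f i + f j   ≤⟨ +-≤-sumFin n f (j≢i ∘ sym) ⟩
  sumFin n f  ≡⟨ sum≡fi ⟩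
  f i         ≡⟨ +-identityʳ (f i) ⟨
  f i + 0     ∎))
  where open ≤-Reasoning

sumFin-mono-≤ : ∀ n {f g : Fin n → ℕ} → (∀ i → f i ≤ g i) → sumFin n f ≤ sumFin n g
sumFin-mono-≤ zero    f≤g = z≤n
sumFin-mono-≤ (suc n) f≤g = +-mono-≤ (f≤g zero) (sumFin-mono-≤ n (f≤g ∘ suc))

+-≤-≡⇒≡ : ∀ {a b c d} → a ≤ b → c ≤ d → a + c ≡ b + d → a ≡ b × c ≡ d
+-≤-≡⇒≡ {a} {b} {c} {d} a≤b c≤d eq = a≡b , +-cancelˡ-≡ a c d (trans eq (cong (_+ d) (sym a≡b)))
  where
  a≡b : a ≡ b
  a≡b = ≤-antisym a≤b (+-cancelʳ-≤ c b a (begin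
    b + c ≤⟨ +-monoʳ-≤ b c≤d ⟩
    b + d ≡⟨ eq ⟨
    a + c ∎))
    where open ≤-Reasoning

sumFin-≤-≡⇒≗ : ∀ n {f g : Fin n → ℕ} → (∀ i → f i ≤ g i) → sumFin n f ≡ sumFin n g → ∀ i → f i ≡ g i
sumFin-≤-≡⇒≗ (suc n) f≤g eq zero    = proj₁ (+-≤-≡⇒≡ (f≤g zero) (sumFin-mono-≤ n (f≤g ∘ suc)) eq)
sumFin-≤-≡⇒≗ (suc n) f≤g eq (suc i) =
  sumFin-≤-≡⇒≗ n (f≤g ∘ suc) (proj₂ (+-≤-≡⇒≡ (f≤g zero) (sumFin-mono-≤ n (f≤g ∘ suc)) eq)) i

sumFin-positive : ∀ n (f : Fin n → ℕ) → 0 < sumFin n f → ∃ λ i → 0 < f i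
sumFin-positive (suc n) f pos with f zero in f₀
... | suc _ = zero , subst (0 <_) (sym f₀) z<s
... | zero  = Product.map suc id (sumFin-positive n (f ∘ suc) pos)

sumFin-≢-indicator : ∀ n (i : Fin n) → sumFin n (λ j → b2n (not (does (j ≟ i)))) ≡ n ∸ 1
sumFin-≢-indicator (suc n) zero    = sumFin-ones n
  where
  sumFin-ones : ∀ n → sumFin n (λ _ → 1) ≡ n
  sumFin-ones zero    = refl
  sumFin-ones (suc n) = cong suc (sumFin-ones n)
sumFin-≢-indicator (suc (suc n)) (suc i) = cong suc (sumFin-≢-indicator (suc n) i)

fibreSum : (Fin m → Fin n) → (Fin m → ℕ) → Fin n → ℕ
fibreSum {m} s w v = sumFin m (λ l → if does (s l ≟ v) then w l else 0)

sumFin-fibreSum : ∀ (s : Fin m → Fin n) w → sumFin n (fibreSum s w) ≡ sumFin m w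
sumFin-fibreSum {m} {n} s w = begin
  sumFin n (fibreSum s w)                                              ≡⟨ sumFin-comm n m _ ⟩
  sumFin m (λ l → sumFin n (λ v → if does (s l ≟ v) then w l else 0))  ≡⟨ sumFin-cong m fibre-of ⟩
  sumFin m w                                                           ∎
  where
  open ≡-Reasoning
  fibre-of : ∀ l → sumFin n (λ v → if does (s l ≟ v) then w l else 0) ≡ w l
  fibre-of l = begin
    sumFin n (λ v → if does (s l ≟ v) then w l else 0)
      ≡⟨ sumFin-singleton-support n (s l) (λ v v≢sl → if-cong (dec-false (s l ≟ v) (v≢sl ∘ sym))) ⟩
    (if does (s l ≟ s l) then w l else 0)
      ≡⟨ if-cong (dec-true (s l ≟ s l) refl) ⟩
    w l ∎

≤-fibreSum : ∀ (s : Fin m → Fin n) w {l v} → s l ≡ v → w l ≤ fibreSum s w v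
≤-fibreSum {m} s w {l} {v} sl≡v = subst (_≤ fibreSum s w v) term≡wl (≤-sumFin m _ l)
  where
  term≡wl : (if does (s l ≟ v) then w l else 0) ≡ w l
  term≡wl = if-cong (dec-true (s l ≟ v) sl≡v)

sumFin-image : ∀ (s : Fin m → Fin n) → (∀ i j → i ≢ j → s i ≢ s j) → ∀ (h : Fin n → ℕ) →
               sumFin n (λ v → if does (any? (λ j → v ≟ s j)) then h v else 0) ≡ sumFin m (h ∘ s)
sumFin-image {m} {n} s s-injective h = trans (sumFin-cong n fibre) (sumFin-fibreSum s (h ∘ s))
  where
  fibre : ∀ v → (if does (any? (λ j → v ≟ s j)) then h v else 0) ≡ fibreSum s (h ∘ s) v
  fibre v with any? (λ j → v ≟ s j)
  ... | no v∉s = sym (sumFin-zero m λ l → if-cong (dec-false (s l ≟ v) (v∉s ∘ (l ,_) ∘ sym)))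
  ... | yes (j , refl) = sym (begin
    fibreSum s (h ∘ s) (s j)
      ≡⟨ sumFin-singleton-support m j (λ l l≢j → if-cong (dec-false (s l ≟ s j) (s-injective l j l≢j))) ⟩
    (if does (s j ≟ s j) then h (s j) else 0)
      ≡⟨ if-cong (dec-true (s j ≟ s j) refl) ⟩
    h (s j) ∎)
    where open ≡-Reasoning

module _ {n : ℕ} (G : Graph n) where

  Adj-sym : ∀ {u v} → Adj G u v ≡ true → Adj G v u ≡ true
  Adj-sym {u} {v} = trans (Graph.sym G v u)

  Adj⇒≢ : ∀ {u v} → Adj G u v ≡ true → u ≢ v
  Adj⇒≢ {u} uv refl = contradiction (trans (sym uv) (irrefl G u)) λ ()

  sumFin-edges≡sumFin-arcs : (a : Fin n → Fin n → ℕ) →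
    sumFin n (λ v → sumFin n (λ w → if does (v <? w) ∧ Adj G v w then a v w + a w v else 0))
    ≡ sumFin n (λ v → sumFin n (λ w → if Adj G v w then a v w else 0))
  sumFin-edges≡sumFin-arcs a = begin
    Σ² (λ v w → if E v w then a v w + a w v else 0)
      ≡⟨ Σ²-cong (λ v w → if-distrib (E v w) _ _) ⟩
    Σ² (λ v w → (if E v w then a v w else 0) + (if E v w then a w v else 0))
      ≡⟨ Σ²-distrib-+ _ _ ⟩
    Σ² (λ v w → if E v w then a v w else 0) + Σ² (λ v w → if E v w then a w v else 0)
      ≡⟨ cong (Σ² (λ v w → if E v w then a v w else 0) +_) (sumFin-comm n n _) ⟩
    Σ² (λ v w → if E v w then a v w else 0) + Σ² (λ v w → if E w v then a v w else 0)
      ≡⟨ Σ²-distrib-+ _ _ ⟨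
    Σ² (λ v w → (if E v w then a v w else 0) + (if E w v then a v w else 0))
      ≡⟨ Σ²-cong (λ v w → orientations v w (a v w)) ⟩
    Σ² (λ v w → if Adj G v w then a v w else 0) ∎
    where
    open ≡-Reasoning
    E : Fin n → Fin n → Bool
    E v w = does (v <? w) ∧ Adj G v w
    Σ² : (Fin n → Fin n → ℕ) → ℕ
    Σ² f = sumFin n (λ v → sumFin n (f v))
    Σ²-cong : ∀ {f g} → (∀ v w → f v w ≡ g v w) → Σ² f ≡ Σ² g
    Σ²-cong f≗g = sumFin-cong n (sumFin-cong n ∘ f≗g)
    Σ²-distrib-+ : ∀ f g → Σ² (λ v w → f v w + g v w) ≡ Σ² f + Σ² g
    Σ²-distrib-+ f g = trans (sumFin-cong n (λ v → sumFin-distrib-+ n (f v) (g v)))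
                             (sumFin-distrib-+ n (λ v → sumFin n (f v)) (λ v → sumFin n (g v)))
    if-distrib : ∀ b (p q : ℕ) → (if b then p + q else 0) ≡ (if b then p else 0) + (if b then q else 0)
    if-distrib true  p q = refl
    if-distrib false p q = refl
    orientations : ∀ v w p → (if E v w then p else 0) + (if E w v then p else 0) ≡ (if Adj G v w then p else 0)
    orientations v w p with <-cmp v w
    ... | tri< v<w _ w≮v rewrite dec-true (v <? w) v<w | dec-false (w <? v) w≮v = +-identityʳ _
    ... | tri≈ _ refl _  rewrite dec-false (v <? v) (<-irrefl refl) | irrefl G v = refl
    ... | tri> v≮w _ w<v rewrite dec-false (v <? w) v≮w | dec-true (w <? v) w<v | Graph.sym G w v = refl

b2n-positive : ∀ {b} → 0 < b2n b → b ≡ true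
b2n-positive {true} _ = refl

if-b2n-positive : ∀ a b → 0 < (if a then b2n b else 0) → a ≡ true × b ≡ true
if-b2n-positive true true _ = refl , refl

module _ {n : ℕ} (G : Graph n) (k : ℕ) where

  edgeSum≡sumFin-nbrSum : ∀ x i → edgeSum G k x i ≡ sumFin n (nbrSum G k x i)
  edgeSum≡sumFin-nbrSum x i = sumFin-edges≡sumFin-arcs G (λ v w → b2n (x i v w))

  arc⇒0<nbrSum : ∀ x i {v w} → Adj G v w ≡ true → x i v w ≡ true → 0 < nbrSum G k x i v
  arc⇒0<nbrSum x i {v} {w} vw x≡true = subst (_≤ nbrSum G k x i v) arc≡1 (≤-sumFin n _ w)
    where
    arc≡1 : (if Adj G v w then b2n (x i v w) else 0) ≡ 1
    arc≡1 rewrite vw | x≡true = refl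

  nbrSum-cong : ∀ {x y} → EqualsOnVars G x y → ∀ i u → nbrSum G k x i u ≡ nbrSum G k y i u
  nbrSum-cong {x} {y} x≗y i u = sumFin-cong n arc
    where
    arc : ∀ v → (if Adj G u v then b2n (x i u v) else 0) ≡ (if Adj G u v then b2n (y i u v) else 0)
    arc v with Adj G u v in uv
    ... | true  = cong b2n (x≗y i u v uv)
    ... | false = refl

  F-cong : ∀ {x y} → EqualsOnVars G x y → F G k y → F G k x
  F-cong {x} {y} x≗y (χy , χEy) = χx , χEx
    where
    open ≡-Reasoning
    edgeSum-cong : ∀ i → edgeSum G k x i ≡ edgeSum G k y i
    edgeSum-cong i = begin
      edgeSum G k x i            ≡⟨ edgeSum≡sumFin-nbrSum x i ⟩
      sumFin n (nbrSum G k x i)  ≡⟨ sumFin-cong n (nbrSum-cong x≗y i) ⟩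
      sumFin n (nbrSum G k y i)  ≡⟨ edgeSum≡sumFin-nbrSum y i ⟨
      edgeSum G k y i            ∎
    χx : ∀ i → χ G k x i
    χx i with χy i
    ... | u , nbr≡ , edge≡ = u , trans (nbrSum-cong x≗y i u) nbr≡ , trans (edgeSum-cong i) edge≡
    χEx : ∀ u v → Adj G u v ≡ true → χE G k x u v
    χEx u v uv with χEy u v uv
    ... | inj₁ (uv≡1 , vu≡1) = inj₁ (trans (sumFin-cong k λ i → cong b2n (x≗y i u v uv)) uv≡1
                                    , trans (sumFin-cong k λ i → cong b2n (x≗y i v u (Adj-sym G uv))) vu≡1)
    ... | inj₂ silent = inj₂ λ i → trans (x≗y i u v uv) (proj₁ (silent i))
                                 , trans (x≗y i v u (Adj-sym G uv)) (proj₂ (silent i))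

  module _ (S : OrderedClique G k) where

    _∈S : Fin n → Set
    v ∈S = ∃ λ j → v ≡ s S j

    α-≢source : ∀ {i u v} → u ≢ s S i → α S i u v ≡ false
    α-≢source {i} {u} u≢si rewrite dec-false (u ≟ s S i) u≢si = refl

    α-∉S : ∀ {i u v} → ¬ v ∈S → α S i u v ≡ false
    α-∉S {i} {u} {v} v∉S rewrite dec-false (any? (λ j → v ≟ s S j)) v∉S =
      trans (cong (does (u ≟ s S i) ∧_) (∧-zeroʳ (Adj G u v))) (∧-zeroʳ _)

    Adj-clique : ∀ i j → Adj G (s S i) (s S j) ≡ not (does (j ≟ i))
    Adj-clique i j with j ≟ i
    ... | yes refl = irrefl G (s S i)
    ... | no j≢i   = adjacent S i j (j≢i ∘ sym)

    nbrSum-α-source : ∀ i → nbrSum G k (α S) i (s S i) ≡ k ∸ 1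
    nbrSum-α-source i = begin
      nbrSum G k (α S) i (s S i)
        ≡⟨ sumFin-cong n arc ⟩
      sumFin n (λ v → if does (any? (λ j → v ≟ s S j)) then b2n (Adj G (s S i) v) else 0)
        ≡⟨ sumFin-image (s S) (distinct S) (b2n ∘ Adj G (s S i)) ⟩
      sumFin k (λ j → b2n (Adj G (s S i) (s S j)))
        ≡⟨ sumFin-cong k (cong b2n ∘ Adj-clique i) ⟩
      sumFin k (λ j → b2n (not (does (j ≟ i))))
        ≡⟨ sumFin-≢-indicator k i ⟩
      k ∸ 1 ∎
      where
      open ≡-Reasoning
      if-b2n-∧ : ∀ a b → (if a then b2n (a ∧ b) else 0) ≡ (if b then b2n a else 0)
      if-b2n-∧ true  true  = refl
      if-b2n-∧ true  false = refl
      if-b2n-∧ false true  = refl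
      if-b2n-∧ false false = refl
      arc : ∀ v → (if Adj G (s S i) v then b2n (α S i (s S i) v) else 0)
                ≡ (if does (any? (λ j → v ≟ s S j)) then b2n (Adj G (s S i) v) else 0)
      arc v rewrite dec-true (s S i ≟ s S i) refl = if-b2n-∧ (Adj G (s S i) v) _

    nbrSum-α-≢source : ∀ i {u} → u ≢ s S i → nbrSum G k (α S) i u ≡ 0
    nbrSum-α-≢source i {u} u≢si =
      sumFin-zero n λ v → trans (if-cong-then (Adj G u v) (cong b2n (α-≢source u≢si))) (if-eta _)

    colourSum-α : ∀ {u v} → u ∈S → v ∈S → Adj G u v ≡ true → sumFin k (λ i → b2n (α S i u v)) ≡ 1
    colourSum-α (a , refl) (b , refl) ab =
      trans (sumFin-singleton-support k a λ i i≢a → cong b2n (α-≢source (distinct S a i (i≢a ∘ sym))))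
            α-a≡1
      where
      α-a≡1 : b2n (α S a (s S a) (s S b)) ≡ 1
      α-a≡1 rewrite dec-true (s S a ≟ s S a) refl | ab
                  | dec-true (any? (λ j → s S b ≟ s S j)) (b , refl) = refl

    α-model : F G k (α S)
    α-model = χα , χEα
      where
      χα : ∀ i → χ G k (α S) i
      χα i = s S i , nbrSum-α-source i , (begin
        edgeSum G k (α S) i             ≡⟨ edgeSum≡sumFin-nbrSum (α S) i ⟩
        sumFin n (nbrSum G k (α S) i)   ≡⟨ sumFin-singleton-support n (s S i) (λ _ → nbrSum-α-≢source i) ⟩
        nbrSum G k (α S) i (s S i)      ≡⟨ nbrSum-α-source i ⟩
        k ∸ 1                           ∎)
        where open ≡-Reasoning
      χEα : ∀ u v → Adj G u v ≡ true → χE G k (α S) u v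
      χEα u v uv = by-membership (any? (λ j → u ≟ s S j)) (any? (λ j → v ≟ s S j))
        where
        by-membership : Dec (u ∈S) → Dec (v ∈S) → χE G k (α S) u v
        by-membership (yes u∈S) (yes v∈S) = inj₁ (colourSum-α u∈S v∈S uv , colourSum-α v∈S u∈S (Adj-sym G uv))
        by-membership (no u∉S)  _         = inj₂ λ i → α-≢source (u∉S ∘ (i ,_)) , α-∉S {i} {v} u∉S
        by-membership (yes _)   (no v∉S)  = inj₂ λ i → α-∉S {i} {u} v∉S , α-≢source (v∉S ∘ (i ,_))

  module Model {x : Assignment k n} (model : F G k x) where

    source : Fin k → Fin n
    source i = proj₁ (proj₁ model i)

    nbrSum-source : ∀ i → nbrSum G k x i (source i) ≡ k ∸ 1
    nbrSum-source i = proj₁ (proj₂ (proj₁ model i))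

    nbrSum-≢source : ∀ i {v} → v ≢ source i → nbrSum G k x i v ≡ 0
    nbrSum-≢source i v≢si = sumFin≡⇒otherSources≡0 n (nbrSum G k x i) v≢si (begin
      sumFin n (nbrSum G k x i)   ≡⟨ edgeSum≡sumFin-nbrSum x i ⟨
      edgeSum G k x i             ≡⟨ proj₂ (proj₂ (proj₁ model i)) ⟩
      k ∸ 1                       ≡⟨ nbrSum-source i ⟨
      nbrSum G k x i (source i)   ∎)
      where open ≡-Reasoning

    arc-from-source : ∀ i {v w} → Adj G v w ≡ true → x i v w ≡ true → v ≡ source i
    arc-from-source i {v} vw x≡true = decidable-stable (v ≟ source i) λ v≢si →
      >⇒≢ (arc⇒0<nbrSum x i vw x≡true) (nbrSum-≢source i v≢si)

    arc-into-sources : ∀ i {v w} → Adj G v w ≡ true → x i v w ≡ true → ∃ λ l → w ≡ source l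
    arc-into-sources i {v} {w} vw x≡true with proj₂ model v w vw
    ... | inj₂ silent = contradiction (trans (sym x≡true) (proj₁ (silent i))) λ ()
    ... | inj₁ (_ , back≡1) with sumFin-positive k (λ l → b2n (x l w v)) (subst (0 <_) (sym back≡1) z<s)
    ...   | l , back = l , arc-from-source l (Adj-sym G vw) (b2n-positive back)

    arcFromSource : Fin k → Fin n → ℕ
    arcFromSource i v = if Adj G (source i) v then b2n (x i (source i) v) else 0

    otherSources : Fin k → Fin n → ℕ
    otherSources i = fibreSum source (λ l → b2n (not (does (l ≟ i))))

    1≤otherSources : ∀ {i l} → l ≢ i → 1 ≤ otherSources i (source l)
    1≤otherSources {i} {l} l≢i =
      subst (_≤ otherSources i (source l)) (cong (b2n ∘ not) (dec-false (l ≟ i) l≢i)) (≤-fibreSum source _ refl)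

    arcFromSource≤otherSources : ∀ i v → arcFromSource i v ≤ otherSources i v
    arcFromSource≤otherSources i v with Adj G (source i) v in siv | x i (source i) v in x≡
    ... | false | _     = z≤n
    ... | true  | false = z≤n
    ... | true  | true  with arc-into-sources i siv x≡
    ...   | l , refl = 1≤otherSources λ l≡i → Adj⇒≢ G siv (cong source (sym l≡i))

    arcFromSource≗otherSources : ∀ i v → arcFromSource i v ≡ otherSources i v
    arcFromSource≗otherSources i = sumFin-≤-≡⇒≗ n (arcFromSource≤otherSources i) (begin
      sumFin n (arcFromSource i)                           ≡⟨ nbrSum-source i ⟩
      k ∸ 1                                      ≡⟨ sumFin-≢-indicator k i ⟨
      sumFin k (λ l → b2n (not (does (l ≟ i))))  ≡⟨ sumFin-fibreSum source _ ⟨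
      sumFin n (otherSources i)                        ∎)
      where open ≡-Reasoning

    arc-between-sources : ∀ i j → i ≢ j → Adj G (source i) (source j) ≡ true × x i (source i) (source j) ≡ true
    arc-between-sources i j i≢j = if-b2n-positive _ _
      (subst (0 <_) (sym (arcFromSource≗otherSources i (source j))) (1≤otherSources (i≢j ∘ sym)))

    clique : OrderedClique G k
    clique = record
      { s        = source
      ; distinct = λ i j i≢j → Adj⇒≢ G (proj₁ (arc-between-sources i j i≢j))
      ; adjacent = λ i j i≢j → proj₁ (arc-between-sources i j i≢j)
      }

    x≗α : EqualsOnVars G x (α clique)
    x≗α i u v uv with u ≟ source i | any? (λ j → v ≟ source j)
    ... | no u≢si   | _        = ¬-not (u≢si ∘ arc-from-source i uv)
    ... | yes _     | no v∉S   rewrite uv = ¬-not (v∉S ∘ arc-into-sources i uv)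
    ... | yes refl  | yes (j , refl) rewrite uv =
      proj₂ (arc-between-sources i j λ i≡j → Adj⇒≢ G uv (cong source i≡j))

-- For k = 0 both sides hold trivially (no colours, the empty clique).
lemma12 : {n : ℕ} (G : Graph n) (k : ℕ) → 0 < k → (x : Assignment k n) →
    (F G k x → Σ (OrderedClique G k) λ S → EqualsOnVars G x (α S))
    × ((Σ (OrderedClique G k) λ S → EqualsOnVars G x (α S)) → F G k x)
lemma12 G k _ x =
    (λ model → Model.clique G k model , Model.x≗α G k model)
  , (λ (S , x≗αS) → F-cong G k x≗αS (α-model G k S))
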